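{- For every odd integer $n\ge 3$, the Cartesian product $W_n'\,\square\, P'$ has no independent dominating set.
   Context: $W_n'$ is the digraph with vertices $c,w_0,\dots,w_{n-1}$ and arcs $(c,w_j)$ for all $j$ and $(w_j,w_{j+1})$ for all $j$ (indices modulo $n$); i.e. a directed wheel on $n+1$ vertices whose centre dominates all other vertices and whose outer cycle is a directed cycle. $P'$ is the oriented paw with vertices $p_0,p_1,p_2,p_3$ and arcs $(p_1,p_2),(p_2,p_3),(p_3,p_1),(p_0,p_3)$. The Cartesian product $G\square H$ of digraphs has vertex set $V(G)\times V(H)$ and an arc from $(x,u)$ to $(y,v)$ iff either $(x,y)\in A(G)$ and $u=v$, or $(u,v)\in A(H)$ and $x=y$. In a digraph, a set $S$ is independent if no arc joins two vertices of $S$, dominating if every vertex not in $S$ has an in-neighbour in $S$, and an independent dominating set if both. -}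

module Defs where

open import Data.Nat as ℕ using (ℕ; suc; _<_; s≤s)
open import Data.Nat.Properties using (≤∧≢⇒<; ≤-pred)
open import Data.Fin using (Fin; zero; suc; toℕ; fromℕ<)
open import Data.Fin.Properties using (toℕ<n)
open import Data.Maybe using (Maybe; just; nothing)
open import Data.Bool using (Bool; true)
open import Data.Product using (_×_; _,_; ∃)
open import Data.Empty using (⊥)
open import Relation.Binary.PropositionalEquality using (_≡_)
open import Relation.Nullary using (¬_; yes; no)

record Digraph : Set₁ where
  field
    V   : Set
    Arc : V → V → Set
open Digraph public

-- j ↦ j + 1 (mod n) on Fin n
sucMod : ∀ {n} → Fin n → Fin n
sucMod {suc k} j with toℕ j ℕ.≟ k
... | yes _ = zero
... | no ne = fromℕ< (s≤s (≤∧≢⇒< (≤-pred (toℕ<n j)) ne))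

-- W'_n : centre c = nothing, w_j = just j; arcs (c, w_j) and (w_j, w_{j+1 mod n}).
data WArc (n : ℕ) : Maybe (Fin n) → Maybe (Fin n) → Set where
  spoke : (j : Fin n) → WArc n nothing (just j)
  rim   : (j : Fin n) → WArc n (just j) (just (sucMod j))

W′ : ℕ → Digraph
W′ n = record { V = Maybe (Fin n) ; Arc = WArc n }

data PArc : Fin 4 → Fin 4 → Set where
  a12 : PArc (suc zero) (suc (suc zero))
  a23 : PArc (suc (suc zero)) (suc (suc (suc zero)))
  a31 : PArc (suc (suc (suc zero))) (suc zero)
  a03 : PArc zero (suc (suc (suc zero)))

P′ : Digraph
P′ = record { V = Fin 4 ; Arc = PArc }

data □Arc (G H : Digraph) : V G × V H → V G × V H → Set where
  left  : ∀ {x y u} → Arc G x y → □Arc G H (x , u) (y , u)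
  right : ∀ {x u v} → Arc H u v → □Arc G H (x , u) (x , v)

_□_ : Digraph → Digraph → Digraph
G □ H = record { V = V G × V H ; Arc = □Arc G H }

Subset : Digraph → Set
Subset G = V G → Bool

_∈_ : ∀ {A : Set} → A → (A → Bool) → Set
x ∈ S = S x ≡ true

Independent : (G : Digraph) → Subset G → Set
Independent G S = ∀ x y → x ∈ S → y ∈ S → Arc G x y → ⊥

Dominating : (G : Digraph) → Subset G → Set
Dominating G S = ∀ y → ¬ (y ∈ S) → ∃ λ x → x ∈ S × Arc G x y

IndependentDominating : (G : Digraph) → Subset G → Set
IndependentDominating G S = Independent G S × Dominating G S

-- Write c for the centre of W′ₙ. The vertex (c, p₀) has no in-neighbour, so it lies in
-- every dominating set S; independence and domination then force (c, p₃) ∉ S, (c, p₁) ∈ S,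
-- (c, p₂) ∉ S and (wᵢ, p₁) ∉ S for all i. The only in-neighbour of (wᵢ₊₁, p₂) that can still
-- lie in S is (wᵢ, p₂), so membership of (wᵢ, p₂) in S alternates along the rim, which is
-- impossible on a cycle of odd length.
module Submission where

open import Defs
open import Data.Nat using (ℕ; _≤_; _%_)
open import Relation.Binary.PropositionalEquality using (_≡_)
open import Relation.Nullary using (¬_)
open import Data.Product using (∃)

open import Data.Bool using (Bool; true; false; not)
import Data.Bool as Bool
open import Data.Bool.Properties using (not-involutive; not-¬; ¬-not)
open import Data.Empty using (⊥)
open import Data.Fin using (Fin; zero; suc; toℕ; fromℕ; inject₁)
open import Data.Fin.Induction using (<-weakInduction)
open import Data.Fin.Properties
  using (toℕ-injective; toℕ-fromℕ<; toℕ-inject₁; toℕ-inject₁-≢; toℕ-fromℕ; toℕ<n; suc-injective)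
open import Data.Maybe using (just; nothing)
open import Data.Nat as ℕ using (zero; suc; s≤s)
open import Data.Nat.GeneralisedArithmetic using (fold)
open import Data.Nat.Properties using (≤∧≢⇒<; ≤-pred)
open import Data.Product using (_,_)
open import Data.Sum using (_⊎_; inj₁; inj₂)
open import Function using (_∘′_)
open import Relation.Binary.PropositionalEquality
  using (refl; sym; trans; cong; subst; module ≡-Reasoning)
open import Relation.Nullary using (yes; no; contradiction)
open import Relation.Nullary.Decidable using (decidable-stable)

sucMod-inject₁ : ∀ {k} (i : Fin k) → sucMod (inject₁ i) ≡ suc i
sucMod-inject₁ {k} i with toℕ (inject₁ i) ℕ.≟ k
... | yes k≡i = contradiction (sym k≡i) (toℕ-inject₁-≢ i)
... | no k≢i  = toℕ-injective (trans (toℕ-fromℕ< i<k) (cong suc (toℕ-inject₁ i)))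
  where i<k = s≤s (≤∧≢⇒< (≤-pred (toℕ<n (inject₁ i))) k≢i)

sucMod-fromℕ : ∀ k → sucMod (fromℕ k) ≡ zero
sucMod-fromℕ k with toℕ (fromℕ k) ℕ.≟ k
... | yes _  = refl
... | no k≢k = contradiction (toℕ-fromℕ k) k≢k

fromℕ-or-inject₁ : ∀ {k} (j : Fin (suc k)) → j ≡ fromℕ k ⊎ ∃ λ i → j ≡ inject₁ i
fromℕ-or-inject₁ {zero}  zero    = inj₁ refl
fromℕ-or-inject₁ {suc k} zero    = inj₂ (zero , refl)
fromℕ-or-inject₁ {suc k} (suc j) with fromℕ-or-inject₁ j
... | inj₁ refl       = inj₁ refl
... | inj₂ (i , refl) = inj₂ (suc i , refl)

sucMod-injective : ∀ {n} {a b : Fin n} → sucMod a ≡ sucMod b → a ≡ b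
sucMod-injective {suc k} {a} {b} eq with fromℕ-or-inject₁ a | fromℕ-or-inject₁ b
... | inj₁ refl       | inj₁ refl        = refl
... | inj₁ refl       | inj₂ (i , refl)  =
  contradiction (trans (sym (sucMod-fromℕ k)) (trans eq (sucMod-inject₁ i))) λ ()
... | inj₂ (i , refl) | inj₁ refl        =
  contradiction (trans (sym (sucMod-fromℕ k)) (trans (sym eq) (sucMod-inject₁ i))) λ ()
... | inj₂ (i , refl) | inj₂ (i′ , refl) =
  cong inject₁ (suc-injective (trans (sym (sucMod-inject₁ i)) (trans eq (sucMod-inject₁ i′))))

fold-not-odd : ∀ b n → n % 2 ≡ 1 → fold b not n ≡ not b
fold-not-odd b (suc zero)    _   = refl
fold-not-odd b (suc (suc n)) odd = trans (not-involutive _) (fold-not-odd b n odd)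

alternating-along-odd-cycle-impossible :
  ∀ k (f : Fin (suc k) → Bool) → (∀ j → f (sucMod j) ≡ not (f j)) → suc k % 2 ≡ 1 → ⊥
alternating-along-odd-cycle-impossible k f alternates odd = not-¬ refl wraps-around
  where
  open ≡-Reasoning
  flips : ∀ i → f i ≡ fold (f zero) not (toℕ i)
  flips = <-weakInduction (λ i → f i ≡ fold (f zero) not (toℕ i)) refl λ i fi≡ → begin
    f (suc i)                                ≡⟨ cong f (sym (sucMod-inject₁ i)) ⟩
    f (sucMod (inject₁ i))                   ≡⟨ alternates (inject₁ i) ⟩
    not (f (inject₁ i))                      ≡⟨ cong not fi≡ ⟩
    not (fold (f zero) not (toℕ (inject₁ i))) ≡⟨ cong (not ∘′ fold (f zero) not) (toℕ-inject₁ i) ⟩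
    not (fold (f zero) not (toℕ i))          ∎
  wraps-around : f zero ≡ not (f zero)
  wraps-around = begin
    f zero                                  ≡⟨ cong f (sym (sucMod-fromℕ k)) ⟩
    f (sucMod (fromℕ k))                    ≡⟨ alternates (fromℕ k) ⟩
    not (f (fromℕ k))                       ≡⟨ cong not (flips (fromℕ k)) ⟩
    not (fold (f zero) not (toℕ (fromℕ k))) ≡⟨ cong (not ∘′ fold (f zero) not) (toℕ-fromℕ k) ⟩
    fold (f zero) not (suc k)               ≡⟨ fold-not-odd (f zero) (suc k) odd ⟩
    not (f zero)                            ∎

module _ (G : Digraph) {S : Subset G} where

  ∉-if-in-neighbour-∈ : Independent G S → ∀ {x y} → x ∈ S → Arc G x y → ¬ y ∈ S
  ∉-if-in-neighbour-∈ independent x∈S xy y∈S = independent _ _ x∈S y∈S xy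

  ∈-if-in-neighbours-∉ : Dominating G S → ∀ {y} → (∀ {x} → Arc G x y → ¬ x ∈ S) → y ∈ S
  ∈-if-in-neighbours-∉ dominating {y} in-neighbours-∉ =
    decidable-stable (S y Bool.≟ true) λ y∉S →
      let (x , x∈S , xy) = dominating y y∉S in in-neighbours-∉ xy x∈S

pattern p0 = zero
pattern p1 = suc zero
pattern p2 = suc (suc zero)
pattern p3 = suc (suc (suc zero))

module _ {n : ℕ} {S : Subset (W′ n □ P′)}
         (independent : Independent (W′ n □ P′) S) (dominating : Dominating (W′ n □ P′) S) where

  private
    ∉-if : ∀ {x y} → x ∈ S → Arc (W′ n □ P′) x y → ¬ y ∈ S
    ∉-if = ∉-if-in-neighbour-∈ (W′ n □ P′) independent

    ∈-if : ∀ {y} → (∀ {x} → Arc (W′ n □ P′) x y → ¬ x ∈ S) → y ∈ S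
    ∈-if = ∈-if-in-neighbours-∉ (W′ n □ P′) dominating

  centre-p0-∈ : (nothing , p0) ∈ S
  centre-p0-∈ = ∈-if λ { (left ()) ; (right ()) }

  centre-p3-∉ : ¬ (nothing , p3) ∈ S
  centre-p3-∉ = ∉-if centre-p0-∈ (right a03)

  centre-p1-∈ : (nothing , p1) ∈ S
  centre-p1-∈ = ∈-if λ { (left ()) ; (right a31) → centre-p3-∉ }

  centre-p2-∉ : ¬ (nothing , p2) ∈ S
  centre-p2-∉ = ∉-if centre-p1-∈ (right a12)

  rim-p1-∉ : ∀ i → ¬ (just i , p1) ∈ S
  rim-p1-∉ i = ∉-if centre-p1-∈ (left (spoke i))

  rim-p2-∈-if-predecessors-∉ : ∀ i → (∀ j → sucMod j ≡ i → ¬ (just j , p2) ∈ S) → (just i , p2) ∈ S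
  rim-p2-∈-if-predecessors-∉ i predecessors-∉ = ∈-if λ
    { (left (spoke _)) → centre-p2-∉
    ; (left (rim j))   → predecessors-∉ j refl
    ; (right a12)      → rim-p1-∉ i
    }

  rim-p2-alternates : ∀ j → S (just (sucMod j) , p2) ≡ not (S (just j , p2))
  rim-p2-alternates j with S (just j , p2) in j∈?
  ... | true  = ¬-not (∉-if j∈? (left (rim j)))
  ... | false = rim-p2-∈-if-predecessors-∉ (sucMod j) λ j′ same j′∈S →
    contradiction (trans (sym (subst (λ i → S (just i , p2) ≡ true) (sucMod-injective same) j′∈S)) j∈?) λ ()

mainTheorem7 : (n : ℕ) → n % 2 ≡ 1 → 3 ≤ n →
    ¬ (∃ λ (S : Subset (W′ n □ P′)) → IndependentDominating (W′ n □ P′) S)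
mainTheorem7 (suc k) odd _ (S , independent , dominating) =
  alternating-along-odd-cycle-impossible k (λ i → S (just i , p2))
    (rim-p2-alternates independent dominating) odd
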